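{- Let $k\ge 1$ and let $G$ be a $2$-connected $k$-cactus. Let $[Q_0,Q_1,\dots,Q_l]$ be an ear decomposition of $G$, where $Q_0$ is a cycle. Then $l\le k-1$.
   Context: All graphs are finite and simple. For an integer $k\ge 1$, a $k$-cactus is a connected graph in which every edge is contained in at most $k$ cycles. For a subgraph $F$ of a graph $H$, an ear of $F$ is a path in $H$ of length at least $1$ whose two (distinct) end-vertices lie in $F$ and whose internal vertices and edges do not lie in $F$. An ear decomposition $[Q_0,Q_1,\dots,Q_l]$ of $G$ is a list of subgraphs such that every edge of $G$ lies in exactly one of them, $Q_0$ is a cycle, and for each $i\ge 1$, $Q_i$ is an ear of $Q_0\cup\cdots\cup Q_{i-1}$ in $G$. -}

module Defs where

open import Data.Nat using (ℕ; _≤_; _∸_)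
open import Data.Fin using (Fin)
open import Data.List using (List; []; _∷_; _++_; [_]; length; lookup)
open import Data.List.Membership.Propositional using (_∈_)
open import Data.List.Relation.Unary.All using (All)
open import Data.List.Relation.Unary.Any using (Any)
open import Data.List.Relation.Unary.AllPairs using (AllPairs)
open import Data.List.Relation.Unary.Unique.Propositional using (Unique)
open import Data.Product using (Σ; _×_)
open import Data.Sum using (_⊎_)
open import Data.Empty using (⊥)
open import Data.Unit using (⊤)
open import Relation.Nullary using (¬_)
open import Relation.Binary.PropositionalEquality using (_≡_)

record Graph (n : ℕ) : Set₁ where
  field
    Adj   : Fin n → Fin n → Set
    sym   : ∀ {u v} → Adj u v → Adj v u
    irref : ∀ {u} → ¬ Adj u u
open Graph public

module _ {n : ℕ} (G : Graph n) where

  Consec : List (Fin n) → Set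
  Consec []           = ⊤
  Consec (x ∷ [])     = ⊤
  Consec (x ∷ y ∷ r)  = Adj G x y × Consec (y ∷ r)

  WalkIn : (Fin n → Set) → Fin n → Fin n → Set
  WalkIn P u v = Σ (List (Fin n)) λ w →
    Σ (List (Fin n)) λ mid → (w ≡ u ∷ mid ++ [ v ]) × Consec w × All P w

  Connected : Set
  Connected = ∀ u v → WalkIn (λ _ → ⊤) u v

  ConnectedWithout : Fin n → Set
  ConnectedWithout x = ∀ u v → ¬ u ≡ x → ¬ v ≡ x → WalkIn (λ w → ¬ w ≡ x) u v

  TwoConnected : Set
  TwoConnected = 3 ≤ n × Connected × (∀ x → ConnectedWithout x)

WalkEdge : {n : ℕ} → List (Fin n) → Fin n → Fin n → Set
WalkEdge []          u v = ⊥
WalkEdge (x ∷ [])    u v = ⊥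
WalkEdge (x ∷ y ∷ r) u v = ((x ≡ u × y ≡ v) ⊎ (x ≡ v × y ≡ u)) ⊎ WalkEdge (y ∷ r) u v

close : {n : ℕ} → List (Fin n) → List (Fin n)
close []      = []
close (x ∷ r) = x ∷ r ++ [ x ]

module _ {n : ℕ} (G : Graph n) where

  IsCycle : List (Fin n) → Set
  IsCycle c = Unique c × 3 ≤ length c × Consec G (close c)

  CycleEdge : List (Fin n) → Fin n → Fin n → Set
  CycleEdge c = WalkEdge (close c)

  -- two cycles are the same subgraph iff they have the same edge set
  SameCycle : List (Fin n) → List (Fin n) → Set
  SameCycle c d = ∀ a b → (CycleEdge c a b → CycleEdge d a b) × (CycleEdge d a b → CycleEdge c a b)

  KCactus : ℕ → Set
  KCactus k = Connected G × (∀ u v → Adj G u v → (cs : List (List (Fin n))) →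
     All IsCycle cs → All (λ c → CycleEdge c u v) cs →
     AllPairs (λ c d → ¬ SameCycle c d) cs → length cs ≤ k)

  IsPath : List (Fin n) → Set
  IsPath p = Unique p × 2 ≤ length p × Consec G p

  -- the subgraph F is represented as a list of walks (vertex lists)
  VertIn : List (List (Fin n)) → Fin n → Set
  VertIn F x = Any (λ w → x ∈ w) F

  EdgeIn : List (List (Fin n)) → Fin n → Fin n → Set
  EdgeIn F u v = Any (λ w → WalkEdge w u v) F

  IsEar : List (List (Fin n)) → List (Fin n) → Set
  IsEar F p = IsPath p × Σ (Fin n) λ a → Σ (List (Fin n)) λ mid → Σ (Fin n) λ b →
    (p ≡ a ∷ mid ++ [ b ]) × VertIn F a × VertIn F b ×
    All (λ x → ¬ VertIn F x) mid × (∀ u v → WalkEdge p u v → ¬ EdgeIn F u v)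

  EarsValid : List (List (Fin n)) → List (List (Fin n)) → Set
  EarsValid F []       = ⊤
  EarsValid F (p ∷ ps) = IsEar F p × EarsValid (F ++ [ p ]) ps

  EarDecomposition : List (Fin n) → List (List (Fin n)) → Set
  EarDecomposition Q0 ears =
    IsCycle Q0 × EarsValid [ close Q0 ] ears ×
    (∀ u v → Adj G u v →
      Σ (Fin (length (close Q0 ∷ ears))) λ i →
        WalkEdge (lookup (close Q0 ∷ ears) i) u v ×
        (∀ j → WalkEdge (lookup (close Q0 ∷ ears) j) u v → j ≡ i))

-- Fix the first edge st of Q0.  Along the decomposition we keep the invariant that any
-- two distinct vertices of the subgraph built so far are joined, inside it, by a path
-- through st.  It holds for the single edge st, and Q0 is that edge plus the ear t ⋯ s.
-- It survives adding an ear c ⋯ d: an interior vertex runs along the ear to an endpoint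
-- other than its target and continues on an old path; interior vertices x before y go
-- back to c, through st to d, and back to y.  Closing each ear c ⋯ d by such a path
-- from d to c gives a cycle through st that uses an edge of the ear, so it differs from
-- the earlier cycles, whose edges are all old.  Hence Q0 and the l ears give l + 1
-- distinct cycles through st, and l + 1 ≤ k.

module Submission where

open import Defs
open import Data.Nat using (ℕ; _≤_; _∸_; _+_; s≤s; z≤n)
open import Data.Nat.Properties using (+-suc; m+n≤o⇒m≤o∸n)
open import Data.Fin using (Fin; _≟_)
open import Data.List using (List; []; _∷_; _++_; [_]; length; reverse)
open import Data.List.Properties using (++-assoc; unfold-reverse; reverse-++; reverse-involutive)
open import Data.List.Membership.Propositional using (_∈_; _∉_)
open import Data.List.Membership.Propositional.Properties
  using (∈-++⁺ˡ; ∈-++⁺ʳ; ∈-++⁻; ∈-∃++; ∈-length)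
open import Data.List.Relation.Unary.All as All using (All; []; _∷_)
import Data.List.Relation.Unary.All.Properties as All
open import Data.List.Relation.Unary.Any using (Any; here; there)
import Data.List.Relation.Unary.Any.Properties as Any
open import Data.List.Relation.Unary.AllPairs as AllPairs using (AllPairs; []; _∷_)
open import Data.List.Relation.Unary.Unique.Propositional using (Unique)
import Data.List.Relation.Unary.Unique.Propositional.Properties as Unique
open import Data.List.Relation.Binary.Disjoint.Propositional using (Disjoint)
import Data.List.Relation.Binary.Disjoint.Propositional.Properties as Disjoint
open import Data.Product as Product using (Σ; ∃; ∃₂; _×_; _,_; proj₁; proj₂)
open import Data.Sum as Sum using (_⊎_; inj₁; inj₂; [_,_]′)
open import Data.Empty using (⊥; ⊥-elim)
open import Data.Unit using (tt)
open import Function using (_∘_)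
open import Relation.Nullary using (¬_; yes; no)
open import Relation.Unary using (Pred; _⊆_; _∪_)
open import Relation.Binary using (_⇒_)
open import Relation.Binary.Construct.Union using () renaming (_∪_ to _∪₂_)
open import Relation.Binary.PropositionalEquality
  using (_≡_; _≢_; refl; trans; cong; subst; module ≡-Reasoning)
  renaming (sym to ≡-sym)

module _ {a} {A : Set a} where

  walk : A → List A → A → List A
  walk x m y = x ∷ m ++ [ y ]

  walk-glue : ∀ x m y m′ z → walk x (m ++ y ∷ m′) z ≡ (x ∷ m) ++ y ∷ (m′ ++ [ z ])
  walk-glue x m y m′ z = cong (x ∷_) (++-assoc m (y ∷ m′) [ z ])

  walk-reverse : ∀ x m y → reverse (walk x m y) ≡ walk y (reverse m) x
  walk-reverse x m y = begin
    reverse (x ∷ m ++ [ y ])     ≡⟨ unfold-reverse x (m ++ [ y ]) ⟩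
    reverse (m ++ [ y ]) ++ [ x ] ≡⟨ cong (_++ [ x ]) (reverse-++ m [ y ]) ⟩
    walk y (reverse m) x          ∎
    where open ≡-Reasoning

  reverse-∷∷ : ∀ (x y : A) r → reverse (x ∷ y ∷ r) ≡ reverse r ++ y ∷ [ x ]
  reverse-∷∷ x y r = begin
    reverse (x ∷ y ∷ r)           ≡⟨ unfold-reverse x (y ∷ r) ⟩
    reverse (y ∷ r) ++ [ x ]      ≡⟨ cong (_++ [ x ]) (unfold-reverse y r) ⟩
    (reverse r ++ [ y ]) ++ [ x ] ≡⟨ ++-assoc (reverse r) [ y ] [ x ] ⟩
    reverse r ++ y ∷ [ x ]        ∎
    where open ≡-Reasoning

  All-reverse⁺ : ∀ {p} {P : Pred A p} {xs} → All P xs → All P (reverse xs)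
  All-reverse⁺ pxs = All.tabulate (All.lookup pxs ∘ Any.reverse⁻)

  All-¬⇒Disjoint : ∀ {p} {P : Pred A p} {xs ys} → All (¬_ ∘ P) xs → All P ys → Disjoint xs ys
  All-¬⇒Disjoint ¬pxs pys (v∈xs , v∈ys) = All.lookup ¬pxs v∈xs (All.lookup pys v∈ys)

  Any-∷ʳ⁺ : ∀ {p} {P : Pred A p} {xs x} → Any P xs ⊎ P x → Any P (xs ++ [ x ])
  Any-∷ʳ⁺ {xs = xs} = [ Any.++⁺ˡ , Any.++⁺ʳ xs ∘ here ]′

  Any-∷ʳ⁻ : ∀ {p} {P : Pred A p} {xs x} → Any P (xs ++ [ x ]) → Any P xs ⊎ P x
  Any-∷ʳ⁻ {xs = xs} = Sum.map₂ (λ { (here px) → px }) ∘ Any.++⁻ xs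

  Unique-++⁻ : ∀ xs {ys : List A} → Unique (xs ++ ys) → Unique xs × Unique ys × Disjoint xs ys
  Unique-++⁻ []       u = [] , u , λ ()
  Unique-++⁻ (x ∷ xs) (x∉ ∷ u) with Unique-++⁻ xs u
  ... | uxs , uys , d = All.++⁻ˡ xs x∉ ∷ uxs , uys , disjoint
    where
    disjoint : Disjoint (x ∷ xs) _
    disjoint (here refl , v∈ys) = All.lookup (All.++⁻ʳ xs x∉) v∈ys refl
    disjoint (there v∈xs , v∈ys) = d (v∈xs , v∈ys)

  Unique-reverse⁺ : ∀ {xs : List A} → Unique xs → Unique (reverse xs)
  Unique-reverse⁺ {[]}     _        = []
  Unique-reverse⁺ {x ∷ xs} (x∉ ∷ u) rewrite unfold-reverse x xs =
    Unique.++⁺ (Unique-reverse⁺ u) ([] ∷ [])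
      λ { (v∈xs , here refl) → All.lookup x∉ (Any.reverse⁻ v∈xs) refl }

  Unique-apart : ∀ xs {x : A} ys {y zs} → Unique (xs ++ x ∷ ys ++ y ∷ zs) →
                 Disjoint (x ∷ reverse xs) (reverse zs ++ [ y ])
  Unique-apart xs {x} ys {y} {zs} u (v∈ˡ , v∈ʳ) with Unique-++⁻ xs u
  ... | _ , x∉ ∷ _ , d = apart v∈ˡ (∈-++⁺ʳ ys (right v∈ʳ))
    where
    right : ∀ {v} → v ∈ reverse zs ++ [ y ] → v ∈ y ∷ zs
    right v∈ with ∈-++⁻ (reverse zs) v∈
    ... | inj₁ v∈zs      = there (Any.reverse⁻ v∈zs)
    ... | inj₂ (here v≡y) = here v≡y
    apart : ∀ {v} → v ∈ x ∷ reverse xs → v ∉ ys ++ y ∷ zs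
    apart (here refl)  v∈ = All.lookup x∉ v∈ refl
    apart (there v∈xs) v∈ = d (Any.reverse⁻ v∈xs , there v∈)

  ∈-walk-reverse : ∀ x m y {v} → v ∈ walk y (reverse m) x → v ∈ walk x m y
  ∈-walk-reverse x m y v∈ = Any.reverse⁻ (subst (_ ∈_) (≡-sym (walk-reverse x m y)) v∈)

  length-≥3 : ∀ (c d : A) m m′ → (m ≡ [] → m′ ≡ [] → ⊥) → 3 ≤ length (c ∷ m ++ d ∷ m′)
  length-≥3 c d (_ ∷ m) m′ _ = s≤s (s≤s (∈-length (∈-++⁺ʳ m (here refl))))
  length-≥3 c d [] (_ ∷ m′) _ = s≤s (s≤s (s≤s z≤n))
  length-≥3 c d [] []       h = ⊥-elim (h refl refl)

  Before : A → A → List A → Set a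
  Before x y l = ∃₂ λ xs ys → ∃ λ zs → l ≡ xs ++ x ∷ ys ++ y ∷ zs

  ∈-order : ∀ {x y} {l : List A} → x ∈ l → y ∈ l → x ≢ y → Before x y l ⊎ Before y x l
  ∈-order {x} {y} x∈l y∈l x≢y with ∈-∃++ x∈l
  ... | xs , ys , refl with ∈-++⁻ xs y∈l
  ...   | inj₂ (here y≡x) = ⊥-elim (x≢y (≡-sym y≡x))
  ...   | inj₂ (there y∈ys) with ∈-∃++ y∈ys
  ...     | ys₁ , zs , refl = inj₁ (xs , ys₁ , zs , refl)
  ∈-order x∈l y∈l x≢y | xs , ys , refl | inj₁ y∈xs with ∈-∃++ y∈xs
  ...     | xs₁ , ys₁ , refl = inj₂ (xs₁ , ys₁ , ys , ++-assoc xs₁ (_ ∷ ys₁) (_ ∷ ys))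

module _ {n : ℕ} where

  private
    V : Set
    V = Fin n

  WalkEdge-++⁻ : ∀ xs {y ys} {u v : V} → WalkEdge (xs ++ y ∷ ys) u v →
                 WalkEdge (xs ++ [ y ]) u v ⊎ WalkEdge (y ∷ ys) u v
  WalkEdge-++⁻ []            e        = inj₂ e
  WalkEdge-++⁻ (x ∷ [])      (inj₁ e) = inj₁ (inj₁ e)
  WalkEdge-++⁻ (x ∷ [])      (inj₂ e) = inj₂ e
  WalkEdge-++⁻ (x ∷ x′ ∷ xs) (inj₁ e) = inj₁ (inj₁ e)
  WalkEdge-++⁻ (x ∷ x′ ∷ xs) (inj₂ e) with WalkEdge-++⁻ (x′ ∷ xs) e
  ... | inj₁ e′ = inj₁ (inj₂ e′)
  ... | inj₂ e′ = inj₂ e′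

  WalkEdge-++⁺ˡ : ∀ xs {y} ys {u v : V} → WalkEdge (xs ++ [ y ]) u v → WalkEdge (xs ++ y ∷ ys) u v
  WalkEdge-++⁺ˡ (x ∷ [])      ys (inj₁ e) = inj₁ e
  WalkEdge-++⁺ˡ (x ∷ x′ ∷ xs) ys (inj₁ e) = inj₁ e
  WalkEdge-++⁺ˡ (x ∷ x′ ∷ xs) ys (inj₂ e) = inj₂ (WalkEdge-++⁺ˡ (x′ ∷ xs) ys e)

  WalkEdge-++⁺ʳ : ∀ xs {y ys} {u v : V} → WalkEdge (y ∷ ys) u v → WalkEdge (xs ++ y ∷ ys) u v
  WalkEdge-++⁺ʳ []            e = e
  WalkEdge-++⁺ʳ (x ∷ [])      e = inj₂ e
  WalkEdge-++⁺ʳ (x ∷ x′ ∷ xs) e = inj₂ (WalkEdge-++⁺ʳ (x′ ∷ xs) e)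

  WalkEdge-reverse⁺ : ∀ xs {u v : V} → WalkEdge xs u v → WalkEdge (reverse xs) u v
  WalkEdge-reverse⁺ (x ∷ y ∷ r) {u} {v} e = subst (λ l → WalkEdge l u v) (≡-sym (reverse-∷∷ x y r)) (step e)
    where
    step : WalkEdge (x ∷ y ∷ r) u v → WalkEdge (reverse r ++ y ∷ [ x ]) u v
    step (inj₁ (inj₁ (x≡u , y≡v))) = WalkEdge-++⁺ʳ (reverse r) (inj₁ (inj₂ (y≡v , x≡u)))
    step (inj₁ (inj₂ (x≡v , y≡u))) = WalkEdge-++⁺ʳ (reverse r) (inj₁ (inj₁ (y≡u , x≡v)))
    step (inj₂ e′) = WalkEdge-++⁺ˡ (reverse r) [ x ]
                       (subst (λ l → WalkEdge l u v) (unfold-reverse y r) (WalkEdge-reverse⁺ (y ∷ r) e′))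

  WalkEdge-reverse⁻ : ∀ xs {u v : V} → WalkEdge (reverse xs) u v → WalkEdge xs u v
  WalkEdge-reverse⁻ xs {u} {v} e =
    subst (λ l → WalkEdge l u v) (reverse-involutive xs) (WalkEdge-reverse⁺ (reverse xs) e)

  WalkEdge-walk-reverse : ∀ x m y {u v : V} → WalkEdge (walk y (reverse m) x) u v → WalkEdge (walk x m y) u v
  WalkEdge-walk-reverse x m y {u} {v} e =
    WalkEdge-reverse⁻ (walk x m y) (subst (λ w → WalkEdge w u v) (≡-sym (walk-reverse x m y)) e)

  walk-first-edge : ∀ (x : V) m y → ∃ λ h → WalkEdge (walk x m y) x h
  walk-first-edge x []      y = y , inj₁ (inj₁ (refl , refl))
  walk-first-edge x (h ∷ _) y = h , inj₁ (inj₁ (refl , refl))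

  WalkEdge-sym : ∀ xs {u v : V} → WalkEdge xs u v → WalkEdge xs v u
  WalkEdge-sym (x ∷ y ∷ r) (inj₁ (inj₁ e)) = inj₁ (inj₂ e)
  WalkEdge-sym (x ∷ y ∷ r) (inj₁ (inj₂ e)) = inj₁ (inj₁ e)
  WalkEdge-sym (x ∷ y ∷ r) (inj₂ e)        = inj₂ (WalkEdge-sym (y ∷ r) e)

module _ {n : ℕ} (G : Graph n) where

  private
    V : Set
    V = Fin n

  Consec-++⁻ : ∀ xs {y ys} → Consec G (xs ++ y ∷ ys) → Consec G (xs ++ [ y ]) × Consec G (y ∷ ys)
  Consec-++⁻ []            c       = tt , c
  Consec-++⁻ (x ∷ [])      (a , c) = (a , tt) , c
  Consec-++⁻ (x ∷ x′ ∷ xs) (a , c) with Consec-++⁻ (x′ ∷ xs) c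
  ... | c₁ , c₂ = (a , c₁) , c₂

  Consec-++⁺ : ∀ xs {y ys} → Consec G (xs ++ [ y ]) → Consec G (y ∷ ys) → Consec G (xs ++ y ∷ ys)
  Consec-++⁺ []            _        c = c
  Consec-++⁺ (x ∷ [])      (a , _)  c = a , c
  Consec-++⁺ (x ∷ x′ ∷ xs) (a , c₁) c = a , Consec-++⁺ (x′ ∷ xs) c₁ c

  Consec-reverse⁺ : ∀ xs → Consec G xs → Consec G (reverse xs)
  Consec-reverse⁺ []          _       = tt
  Consec-reverse⁺ (x ∷ [])    _       = tt
  Consec-reverse⁺ (x ∷ y ∷ r) (a , c) = subst (Consec G) (≡-sym (reverse-∷∷ x y r))
    (Consec-++⁺ (reverse r) (subst (Consec G) (unfold-reverse y r) (Consec-reverse⁺ (y ∷ r) c))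
                            (Graph.sym G a , tt))

  record PathIn (P : V → Set) (E : V → V → Set) (w : List V) : Set where
    field
      unique   : Unique w
      consec   : Consec G w
      vertices : All P w
      edges    : WalkEdge w ⇒ E

  module _ {P : V → Set} {E : V → V → Set} where

    PathIn-mono : ∀ {P′ E′ w} → P ⊆ P′ → E ⇒ E′ → PathIn P E w → PathIn P′ E′ w
    PathIn-mono P⊆P′ E⇒E′ p = record
      { unique   = PathIn.unique p
      ; consec   = PathIn.consec p
      ; vertices = All.map P⊆P′ (PathIn.vertices p)
      ; edges    = E⇒E′ ∘ PathIn.edges p
      }

    PathIn-reverse : ∀ {w} → PathIn P E w → PathIn P E (reverse w)
    PathIn-reverse {w} p = record
      { unique   = Unique-reverse⁺ (PathIn.unique p)
      ; consec   = Consec-reverse⁺ w (PathIn.consec p)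
      ; vertices = All-reverse⁺ (PathIn.vertices p)
      ; edges    = PathIn.edges p ∘ WalkEdge-reverse⁻ w
      }

    PathIn-++⁺ : ∀ xs {y ys} → PathIn P E (xs ++ [ y ]) → PathIn P E (y ∷ ys) → Disjoint xs ys →
                 PathIn P E (xs ++ y ∷ ys)
    PathIn-++⁺ xs {y} {ys} p q d with Unique-++⁻ xs (PathIn.unique p)
    ... | uxs , _ , d₁ = record
      { unique   = Unique.++⁺ uxs (PathIn.unique q) disjoint
      ; consec   = Consec-++⁺ xs (PathIn.consec p) (PathIn.consec q)
      ; vertices = All.++⁺ (All.++⁻ˡ xs (PathIn.vertices p)) (PathIn.vertices q)
      ; edges    = [ PathIn.edges p , PathIn.edges q ]′ ∘ WalkEdge-++⁻ xs
      }
      where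
      disjoint : Disjoint xs (y ∷ ys)
      disjoint (v∈xs , here refl)  = d₁ (v∈xs , here refl)
      disjoint (v∈xs , there v∈ys) = d (v∈xs , v∈ys)

    PathIn-++⁻ : ∀ xs {y ys} → PathIn P E (xs ++ y ∷ ys) → PathIn P E (xs ++ [ y ]) × PathIn P E (y ∷ ys)
    PathIn-++⁻ xs {y} {ys} p with Unique-++⁻ xs (PathIn.unique p) | Consec-++⁻ xs (PathIn.consec p)
    ... | uxs , uys , d | cxs , cys = record
      { unique   = Unique.++⁺ uxs ([] ∷ []) λ { (v∈xs , here refl) → d (v∈xs , here refl) }
      ; consec   = cxs
      ; vertices = All.++⁺ (All.++⁻ˡ xs (PathIn.vertices p)) (All.head (All.++⁻ʳ xs (PathIn.vertices p)) ∷ [])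
      ; edges    = PathIn.edges p ∘ WalkEdge-++⁺ˡ xs ys
      } , record
      { unique   = uys
      ; consec   = cys
      ; vertices = All.++⁻ʳ xs (PathIn.vertices p)
      ; edges    = PathIn.edges p ∘ WalkEdge-++⁺ʳ xs
      }

    PathIn-walk-reverse : ∀ {x m y} → PathIn P E (walk x m y) → PathIn P E (walk y (reverse m) x)
    PathIn-walk-reverse {x} {m} {y} p = subst (PathIn P E) (walk-reverse x m y) (PathIn-reverse p)

    PathIn-walk-glue : ∀ {x m y m′ z} → PathIn P E (walk x m y) → PathIn P E (walk y m′ z) →
                       Disjoint (x ∷ m) (m′ ++ [ z ]) → PathIn P E (walk x (m ++ y ∷ m′) z)
    PathIn-walk-glue {x} {m} {y} {m′} {z} p q d =
      subst (PathIn P E) (≡-sym (walk-glue x m y m′ z)) (PathIn-++⁺ (x ∷ m) p q d)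

    PathIn-walk-split : ∀ {x m y m′ z} → PathIn P E (walk x (m ++ y ∷ m′) z) →
                        PathIn P E (walk x m y) × PathIn P E (walk y m′ z)
    PathIn-walk-split {x} {m} {y} {m′} {z} p =
      PathIn-++⁻ (x ∷ m) (subst (PathIn P E) (walk-glue x m y m′ z) p)

  record Ear (P : V → Set) (c : V) (m : List V) (d : V) : Set where
    field
      unique   : Unique (walk c m d)
      consec   : Consec G (walk c m d)
      start    : P c
      end      : P d
      interior : All (¬_ ∘ P) m

  module _ {P : V → Set} {c m d} (ear : Ear P c m d) where

    Ear-reverse : Ear P d (reverse m) c
    Ear-reverse = record
      { unique   = subst Unique (walk-reverse c m d) (Unique-reverse⁺ (Ear.unique ear))
      ; consec   = subst (Consec G) (walk-reverse c m d) (Consec-reverse⁺ (walk c m d) (Ear.consec ear))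
      ; start    = Ear.end ear
      ; end      = Ear.start ear
      ; interior = All-reverse⁺ (Ear.interior ear)
      }

    Ear-ends-distinct : c ≢ d
    Ear-ends-distinct c≡d = Unique.Unique[x∷xs]⇒x∉xs (Ear.unique ear) (∈-++⁺ʳ m (here c≡d))

    Ear-interior-unique : Unique m
    Ear-interior-unique = proj₁ (Unique-++⁻ m (AllPairs.tail (Ear.unique ear)))

    Ear-path : ∀ {E} → PathIn (P ∪ (_∈ walk c m d)) (E ∪₂ WalkEdge (walk c m d)) (walk c m d)
    Ear-path = record
      { unique   = Ear.unique ear
      ; consec   = Ear.consec ear
      ; vertices = All.tabulate inj₂
      ; edges    = inj₂
      }

    Ear-classify : ∀ {v} → (P ∪ (_∈ walk c m d)) v → P v ⊎ v ∈ m
    Ear-classify (inj₁ Pv)          = inj₁ Pv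
    Ear-classify (inj₂ (here refl)) = inj₁ (Ear.start ear)
    Ear-classify (inj₂ (there v∈))  with ∈-++⁻ m v∈
    ... | inj₁ v∈m         = inj₂ v∈m
    ... | inj₂ (here refl) = inj₁ (Ear.end ear)

  module _ (s t : V) where

    PathVia : (V → Set) → (V → V → Set) → V → V → Set
    PathVia P E x y = Σ (List V) λ m → PathIn P E (walk x m y) × WalkEdge (walk x m y) s t

    ViaConnected : (V → Set) → (V → V → Set) → Set
    ViaConnected P E = ∀ {x y} → P x → P y → x ≢ y → PathVia P E x y

    module _ {P : V → Set} {E : V → V → Set} where

      PathVia-mono : ∀ {P′ E′ x y} → P ⊆ P′ → E ⇒ E′ → PathVia P E x y → PathVia P′ E′ x y
      PathVia-mono P⊆P′ E⇒E′ (m , p , st) = m , PathIn-mono P⊆P′ E⇒E′ p , st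

      PathVia-reverse : ∀ {x y} → PathVia P E x y → PathVia P E y x
      PathVia-reverse {x} {y} (m , p , st) =
        reverse m , PathIn-walk-reverse p ,
        subst (λ w → WalkEdge w s t) (walk-reverse x m y) (WalkEdge-reverse⁺ (walk x m y) st)

      PathVia-prepend : ∀ {x m y z} → PathIn P E (walk x m y) → ((m′ , _) : PathVia P E y z) →
                        Disjoint (x ∷ m) (m′ ++ [ z ]) → PathVia P E x z
      PathVia-prepend {x} {m} {y} {z} p (m′ , q , st) d =
        m ++ y ∷ m′ , PathIn-walk-glue p q d ,
        subst (λ w → WalkEdge w s t) (≡-sym (walk-glue x m y m′ z)) (WalkEdge-++⁺ʳ (x ∷ m) st)

      PathVia-append : ∀ {x y m z} → ((m′ , _) : PathVia P E x y) → PathIn P E (walk y m z) →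
                       Disjoint (x ∷ m′) (m ++ [ z ]) → PathVia P E x z
      PathVia-append {x} {y} {m} {z} (m′ , p , st) q d =
        m′ ++ y ∷ m , PathIn-walk-glue p q d ,
        subst (λ w → WalkEdge w s t) (≡-sym (walk-glue x m′ y m z)) (WalkEdge-++⁺ˡ (x ∷ m′) (m ++ [ z ]) st)

    module _ {P : V → Set} {E : V → V → Set} (conn : ViaConnected P E) where

      toward-end : ∀ {c m d x y} → Ear P c m d → x ∈ m → P y → y ≢ d →
                   PathVia (P ∪ (_∈ walk c m d)) (E ∪₂ WalkEdge (walk c m d)) x y
      toward-end ear x∈m Py y≢d with ∈-∃++ x∈m | conn (Ear.end ear) Py (y≢d ∘ ≡-sym)
      ... | xs , ys , refl | om , p , st =
        PathVia-prepend (proj₂ (PathIn-walk-split (Ear-path ear)))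
                        (om , PathIn-mono inj₁ inj₁ p , st)
                        (All-¬⇒Disjoint (All.++⁻ʳ xs (Ear.interior ear)) (All.tail (PathIn.vertices p)))

      from-interior : ∀ {c m d x y} → Ear P c m d → x ∈ m → P y →
                      PathVia (P ∪ (_∈ walk c m d)) (E ∪₂ WalkEdge (walk c m d)) x y
      from-interior {c} {m} {d} {y = y} ear x∈m Py with y ≟ d
      ... | no y≢d   = toward-end ear x∈m Py y≢d
      ... | yes refl =
        PathVia-mono (Sum.map₂ (∈-walk-reverse c m d)) (Sum.map₂ (WalkEdge-walk-reverse c m d))
          (toward-end (Ear-reverse ear) (Any.reverse⁺ x∈m) Py (Ear-ends-distinct ear ∘ ≡-sym))

      between-interior : ∀ {c m d x y} → Ear P c m d → Before x y m →
                         PathVia (P ∪ (_∈ walk c m d)) (E ∪₂ WalkEdge (walk c m d)) x y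
      between-interior {c} {m} {d} {x} {y} ear (xs , ys , zs , refl)
        with PathIn-walk-split {m = xs} (Ear-path ear)
           | conn (Ear.start ear) (Ear.end ear) (Ear-ends-distinct ear)
      ... | c⋯x , x⋯d | om , p , st with PathIn-walk-split {m = ys} x⋯d
      ... | _ , y⋯d = PathVia-prepend (PathIn-walk-reverse c⋯x) c⋯y disjoint-x⋯y
        where
        ¬P-x⋯zs : All (¬_ ∘ P) (x ∷ ys ++ y ∷ zs)
        ¬P-x⋯zs = All.++⁻ʳ xs (Ear.interior ear)
        ¬P-x∷xs⁻¹ : All (¬_ ∘ P) (x ∷ reverse xs)
        ¬P-x∷xs⁻¹ = All.head ¬P-x⋯zs ∷ All-reverse⁺ (All.++⁻ˡ xs (Ear.interior ear))
        ¬P-y∷zs : All (¬_ ∘ P) (y ∷ zs)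
        ¬P-y∷zs = All.++⁻ʳ ys (All.tail ¬P-x⋯zs)
        P-c∷om : All P (c ∷ om)
        P-c∷om = All.++⁻ˡ (c ∷ om) (PathIn.vertices p)
        c⋯y : PathVia (P ∪ (_∈ walk c m d)) (E ∪₂ WalkEdge (walk c m d)) c y
        c⋯y = PathVia-append (om , PathIn-mono inj₁ inj₁ p , st) (PathIn-walk-reverse y⋯d)
                (Disjoint.sym (All-¬⇒Disjoint (All.++⁺ (All-reverse⁺ (All.tail ¬P-y∷zs)) (All.head ¬P-y∷zs ∷ []))
                                              P-c∷om))
        disjoint-x⋯y : Disjoint (x ∷ reverse xs) ((om ++ d ∷ reverse zs) ++ [ y ])
        disjoint-x⋯y (v∈ˡ , v∈ʳ) with ∈-++⁻ om (subst (_ ∈_) (++-assoc om (d ∷ reverse zs) [ y ]) v∈ʳ)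
        ... | inj₁ v∈om        = All-¬⇒Disjoint ¬P-x∷xs⁻¹ (All.tail P-c∷om) (v∈ˡ , v∈om)
        ... | inj₂ (here refl) = All.lookup ¬P-x∷xs⁻¹ v∈ˡ (Ear.end ear)
        ... | inj₂ (there v∈)  = Unique-apart xs ys (Ear-interior-unique ear) (v∈ˡ , v∈)

      ear-extends : ∀ {c m d} → Ear P c m d → ViaConnected (P ∪ (_∈ walk c m d)) (E ∪₂ WalkEdge (walk c m d))
      ear-extends ear Px Py x≢y with Ear-classify ear Px | Ear-classify ear Py
      ... | inj₁ Px′ | inj₁ Py′ = PathVia-mono inj₁ inj₁ (conn Px′ Py′ x≢y)
      ... | inj₂ x∈m | inj₁ Py′ = from-interior ear x∈m Py′
      ... | inj₁ Px′ | inj₂ y∈m = PathVia-reverse (from-interior ear y∈m Px′)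
      ... | inj₂ x∈m | inj₂ y∈m with ∈-order x∈m y∈m x≢y
      ...   | inj₁ x⋯y = between-interior ear x⋯y
      ...   | inj₂ y⋯x = PathVia-reverse (between-interior ear y⋯x)

    record CycleFamily (E : V → V → Set) (cs : List (List V)) : Set where
      field
        cycles   : All (IsCycle G) cs
        through  : All (λ c → CycleEdge G c s t) cs
        distinct : AllPairs (λ c c′ → ¬ SameCycle G c c′) cs
        inside   : All (λ c → CycleEdge G c ⇒ E) cs

    ear-closes-cycle : ∀ {P E c m d cs} → ViaConnected P E → Ear P c m d →
                       (∀ {u v} → WalkEdge (walk c m d) u v → ¬ E u v) → CycleFamily E cs →
                       ∃ λ cyc → CycleFamily (E ∪₂ WalkEdge (walk c m d)) (cyc ∷ cs)
    ear-closes-cycle {E = E} {c} {m} {d} conn ear fresh family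
      with conn (Ear.end ear) (Ear.start ear) (Ear-ends-distinct ear ∘ ≡-sym)
    ... | qm , q , st = c ∷ m ++ d ∷ qm , record
      { cycles   = (Unique.++⁺ (proj₁ (Unique-++⁻ (c ∷ m) (Ear.unique ear))) (proj₁ uq) disjoint ,
                    length-≥3 c d m qm not-digon ,
                    subst (Consec G) (≡-sym closed) (Consec-++⁺ (c ∷ m) (Ear.consec ear) (PathIn.consec q)))
                   ∷ CycleFamily.cycles family
      ; through  = subst (λ w → WalkEdge w s t) (≡-sym closed) (WalkEdge-++⁺ʳ (c ∷ m) st)
                   ∷ CycleFamily.through family
      ; distinct = All.map differs (CycleFamily.inside family) ∷ CycleFamily.distinct family
      ; inside   = inside ∷ All.map (λ old {_} {_} e → inj₁ (old e)) (CycleFamily.inside family)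
      }
      where
      closed : walk c (m ++ d ∷ qm) c ≡ (c ∷ m) ++ d ∷ (qm ++ [ c ])
      closed = walk-glue c m d qm c
      uq : Unique (d ∷ qm) × Unique [ c ] × Disjoint (d ∷ qm) [ c ]
      uq = Unique-++⁻ (d ∷ qm) (PathIn.unique q)
      disjoint : Disjoint (c ∷ m) (d ∷ qm)
      disjoint (here refl , here refl)  = Ear-ends-distinct ear refl
      disjoint (here refl , there v∈qm) = proj₂ (proj₂ uq) (there v∈qm , here refl)
      disjoint (there v∈m , v∈)         =
        All-¬⇒Disjoint (Ear.interior ear) (All.++⁻ˡ (d ∷ qm) (PathIn.vertices q)) (v∈m , v∈)
      not-digon : m ≡ [] → qm ≡ [] → ⊥
      not-digon refl refl = fresh (inj₁ (inj₁ (refl , refl)))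
                                  (PathIn.edges q (WalkEdge-sym (d ∷ [ c ]) (inj₁ (inj₁ (refl , refl)))))
      inside : CycleEdge G (c ∷ m ++ d ∷ qm) ⇒ (E ∪₂ WalkEdge (walk c m d))
      inside {u} {v} e with WalkEdge-++⁻ (c ∷ m) (subst (λ w → WalkEdge w u v) closed e)
      ... | inj₁ e-ear = inj₂ e-ear
      ... | inj₂ e-old = inj₁ (PathIn.edges q e-old)
      differs : ∀ {c′} → CycleEdge G c′ ⇒ E → ¬ SameCycle G (c ∷ m ++ d ∷ qm) c′
      differs {c′} old same with walk-first-edge c m d
      ... | h , e = fresh e (old (proj₁ (same c h)
                      (subst (λ w → WalkEdge w c h) (≡-sym closed) (WalkEdge-++⁺ˡ (c ∷ m) (qm ++ [ c ]) e))))

    ViaConnected-resp : ∀ {P P′ E E′} → P′ ⊆ P → P ⊆ P′ → E ⇒ E′ → ViaConnected P E → ViaConnected P′ E′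
    ViaConnected-resp P′⊆P P⊆P′ E⇒E′ conn Px Py x≢y = PathVia-mono P⊆P′ E⇒E′ (conn (P′⊆P Px) (P′⊆P Py) x≢y)

    CycleFamily-mono : ∀ {E E′ cs} → E ⇒ E′ → CycleFamily E cs → CycleFamily E′ cs
    CycleFamily-mono E⇒E′ family = record
      { cycles   = CycleFamily.cycles family
      ; through  = CycleFamily.through family
      ; distinct = CycleFamily.distinct family
      ; inside   = All.map (λ old {_} {_} e → E⇒E′ (old e)) (CycleFamily.inside family)
      }

    ear-step : ∀ {F p cs} → ViaConnected (VertIn G F) (EdgeIn G F) → IsEar G F p → CycleFamily (EdgeIn G F) cs →
               ViaConnected (VertIn G (F ++ [ p ])) (EdgeIn G (F ++ [ p ])) ×
               ∃ λ cyc → CycleFamily (EdgeIn G (F ++ [ p ])) (cyc ∷ cs)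
    ear-step conn ((unique , _ , consec) , c , m , d , refl , Fc , Fd , interior , fresh) family =
      ViaConnected-resp Any-∷ʳ⁻ Any-∷ʳ⁺ Any-∷ʳ⁺ (ear-extends conn ear) ,
      Product.map₂ (CycleFamily-mono Any-∷ʳ⁺) (ear-closes-cycle conn ear (fresh _ _) family)
      where
      ear : Ear (VertIn G _) c m d
      ear = record { unique = unique ; consec = consec ; start = Fc ; end = Fd ; interior = interior }

    ears-give-cycles : ∀ {F cs} ears → ViaConnected (VertIn G F) (EdgeIn G F) → EarsValid G F ears →
                       CycleFamily (EdgeIn G F) cs →
                       ∃₂ λ F′ cs′ → CycleFamily (EdgeIn G F′) cs′ × length ears + length cs ≡ length cs′
    ears-give-cycles []       conn _ family = _ , _ , family , refl
    ears-give-cycles {cs = cs} (p ∷ ps) conn (is-ear , valid) family with ear-step conn is-ear family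
    ... | conn′ , _ , family′ with ears-give-cycles ps conn′ valid family′
    ... | F′ , cs′ , family″ , eq = F′ , cs′ , family″ , trans (≡-sym (+-suc (length ps) (length cs))) eq

    edge-ViaConnected : Adj G s t → ViaConnected (_∈ s ∷ [ t ]) (WalkEdge (s ∷ [ t ]))
    edge-ViaConnected adj = connect
      where
      s⋯t : PathVia (_∈ s ∷ [ t ]) (WalkEdge (s ∷ [ t ])) s t
      s⋯t = [] , record { unique   = (s≢t ∷ []) ∷ [] ∷ []
                        ; consec   = adj , tt
                        ; vertices = All.tabulate (λ v∈ → v∈)
                        ; edges    = λ e → e
                        } ,
            inj₁ (inj₁ (refl , refl))
        where
        s≢t : s ≢ t
        s≢t refl = irref G adj
      connect : ViaConnected (_∈ s ∷ [ t ]) (WalkEdge (s ∷ [ t ]))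
      connect (here refl)         (here refl)         x≢y = ⊥-elim (x≢y refl)
      connect (here refl)         (there (here refl)) _   = s⋯t
      connect (there (here refl)) (here refl)         _   = PathVia-reverse s⋯t
      connect (there (here refl)) (there (here refl)) x≢y = ⊥-elim (x≢y refl)

    cycle-ViaConnected : ∀ {r} → IsCycle G (s ∷ t ∷ r) →
                         ViaConnected (VertIn G [ close (s ∷ t ∷ r) ]) (EdgeIn G [ close (s ∷ t ∷ r) ])
    cycle-ViaConnected {r} ((s∉ ∷ unique@(t∉ ∷ _)) , _ , adj , consec) =
      ViaConnected-resp split join join-edges (ear-extends (edge-ViaConnected adj) ear)
      where
      ear : Ear (_∈ s ∷ [ t ]) t r s
      ear = record
        { unique   = Unique.++⁺ unique ([] ∷ []) λ { (v∈ , here refl) → All.lookup s∉ v∈ refl }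
        ; consec   = consec
        ; start    = there (here refl)
        ; end      = here refl
        ; interior = All.tabulate λ
            { v∈r (here refl)         → All.lookup s∉ (there v∈r) refl
            ; v∈r (there (here refl)) → All.lookup t∉ v∈r refl }
        }
      split : VertIn G [ close (s ∷ t ∷ r) ] ⊆ ((_∈ s ∷ [ t ]) ∪ (_∈ walk t r s))
      split (here (here v≡s)) = inj₁ (here v≡s)
      split (here (there v∈)) = inj₂ v∈
      join : ((_∈ s ∷ [ t ]) ∪ (_∈ walk t r s)) ⊆ VertIn G [ close (s ∷ t ∷ r) ]
      join (inj₁ (here v≡s))         = here (here v≡s)
      join (inj₁ (there (here v≡t))) = here (there (here v≡t))
      join (inj₂ v∈)                 = here (there v∈)
      join-edges : (WalkEdge (s ∷ [ t ]) ∪₂ WalkEdge (walk t r s)) ⇒ EdgeIn G [ close (s ∷ t ∷ r) ]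
      join-edges (inj₁ (inj₁ e)) = here (inj₁ e)
      join-edges (inj₂ e)        = here (inj₂ e)

    cycle-family : ∀ {r} → IsCycle G (s ∷ t ∷ r) → CycleFamily (EdgeIn G [ close (s ∷ t ∷ r) ]) [ s ∷ t ∷ r ]
    cycle-family is-cycle = record
      { cycles   = is-cycle ∷ []
      ; through  = inj₁ (inj₁ (refl , refl)) ∷ []
      ; distinct = [] ∷ []
      ; inside   = here ∷ []
      }

lemma8 : (k : ℕ) → 1 ≤ k → (n : ℕ) → (G : Graph n) → TwoConnected G → KCactus G k →
    (Q0 : List (Fin n)) → (ears : List (List (Fin n))) → EarDecomposition G Q0 ears →
    length ears ≤ k ∸ 1
lemma8 k _ n G _ _ []       ears ((_ , () , _) , _)
lemma8 k _ n G _ _ (_ ∷ []) ears ((_ , s≤s () , _) , _)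
lemma8 k _ n G _ (_ , cactus) (s ∷ t ∷ r) ears (is-cycle@(_ , _ , adj , _) , valid , _)
  with ears-give-cycles G s t ears (cycle-ViaConnected G s t is-cycle) valid (cycle-family G s t is-cycle)
... | _ , cs , family , eq =
  m+n≤o⇒m≤o∸n (length ears)
    (subst (_≤ k) (≡-sym eq) (cactus s t adj cs (CycleFamily.cycles family) (CycleFamily.through family)
                                                 (CycleFamily.distinct family)))
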